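{- Let $n\ge1$ and let $\lambda=(\lambda_1,\ldots,\lambda_n)$ be a partition of $n(n-1)$ with $n-1\le\ell(\lambda)\le n$ and $\langle a_{\delta_n}^2,s_\lambda\rangle\ne0$. If $\lambda_1=\lambda_2=\cdots=\lambda_i=2n-m-1$ for some positive integers $i,m$, then $i\le m$.
   Context: $\ell(\lambda)$ is the number of nonzero parts of $\lambda$. $a_{\delta_n}=\prod_{1\le i<j\le n}(x_i-x_j)$ is the Vandermonde determinant in $x_1,\ldots,x_n$. For a symmetric polynomial $f$ in $x_1,\ldots,x_n$ and a partition $\lambda$ with at most $n$ parts, $\langle f,s_\lambda\rangle$ denotes the coefficient of the Schur polynomial $s_\lambda(x_1,\ldots,x_n)$ in the expansion of $f$ in the Schur basis. -}

module Defs where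

open import Data.Nat as ℕ using (ℕ; zero; suc; _≤ᵇ_; _<ᵇ_; _≡ᵇ_; _≤_)
open import Data.Integer as ℤ using (ℤ; +_)
open import Data.List as L using (List; []; _∷_; _++_; concatMap; map; foldr; upTo; allFin; zip)
open import Data.Vec as V using (Vec; []; _∷_)
import Data.Vec.Properties as VP
open import Data.Fin as F using (Fin; toℕ)
open import Data.Bool using (Bool; true; false; if_then_else_; _∧_)
open import Data.Product using (_×_; _,_)
open import Relation.Nullary.Decidable using (⌊_⌋)
open import Relation.Binary.PropositionalEquality using (_≡_)

-- Polynomials in x_1,...,x_n with integer coefficients, represented as
-- formal finite sums of terms (coefficient, exponent vector).

Monomial : ℕ → Set
Monomial n = Vec ℕ n

Poly : ℕ → Set
Poly n = List (ℤ × Monomial n)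

coeff : ∀ {n} → Poly n → Monomial n → ℤ
coeff [] e = + 0
coeff ((a , f) ∷ p) e =
  (if ⌊ VP.≡-dec ℕ._≟_ f e ⌋ then a else + 0) ℤ.+ coeff p e

infix 4 _≈_
_≈_ : ∀ {n} → Poly n → Poly n → Set
p ≈ q = ∀ e → coeff p e ≡ coeff q e

_⊕_ : ∀ {n} → Poly n → Poly n → Poly n
p ⊕ q = p ++ q

scale : ∀ {n} → ℤ → Poly n → Poly n
scale c p = map (λ { (a , e) → (c ℤ.* a , e) }) p

neg : ∀ {n} → Poly n → Poly n
neg = scale (ℤ.- (+ 1))

_⊗_ : ∀ {n} → Poly n → Poly n → Poly n
p ⊗ q = concatMap (λ { (a , e) → map (λ { (b , f) → (a ℤ.* b , V.zipWith ℕ._+_ e f) }) q }) p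

one : ∀ {n} → Poly n
one {n} = (+ 1 , V.replicate n 0) ∷ []

-- the variable x_{i+1}
var : ∀ {n} → Fin n → Poly n
var {n} i = (+ 1 , V.tabulate (λ j → if ⌊ j F.≟ i ⌋ then 1 else 0)) ∷ []

pairs : (n : ℕ) → List (Fin n × Fin n)
pairs n = concatMap (λ i → concatMap (λ j → if toℕ i <ᵇ toℕ j then (i , j) ∷ [] else []) (allFin n)) (allFin n)

vandermonde : (n : ℕ) → Poly n
vandermonde n = foldr (λ { (i , j) acc → (var i ⊕ neg (var j)) ⊗ acc }) one (pairs n)

-- Schur polynomials s_λ(x_1,...,x_n) = Σ_{T ∈ SSYT(λ), entries in [n]} x^T.
-- A tableau is a list of rows; entry k (0 ≤ k < n) stands for the letter k+1.

filterᵇ : {A : Set} → (A → Bool) → List A → List A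
filterᵇ p [] = []
filterᵇ p (x ∷ xs) = if p x then x ∷ filterᵇ p xs else filterᵇ p xs

allᵇ : {A : Set} → (A → Bool) → List A → Bool
allᵇ p [] = true
allᵇ p (x ∷ xs) = p x ∧ allᵇ p xs

words : ℕ → ℕ → List (List ℕ)
words n zero = [] ∷ []
words n (suc k) = concatMap (λ a → map (a ∷_) (words n k)) (upTo n)

fillings : ℕ → List ℕ → List (List (List ℕ))
fillings n [] = [] ∷ []
fillings n (r ∷ rs) = concatMap (λ w → map (w ∷_) (fillings n rs)) (words n r)

weaklyIncᵇ : List ℕ → Bool
weaklyIncᵇ [] = true
weaklyIncᵇ (a ∷ []) = true
weaklyIncᵇ (a ∷ b ∷ xs) = (a ≤ᵇ b) ∧ weaklyIncᵇ (b ∷ xs)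

colStrictᵇ : List (List ℕ) → Bool
colStrictᵇ [] = true
colStrictᵇ (r ∷ []) = true
colStrictᵇ (r ∷ r' ∷ rs) = allᵇ (λ { (a , b) → a <ᵇ b }) (zip r r') ∧ colStrictᵇ (r' ∷ rs)

isSSYTᵇ : List (List ℕ) → Bool
isSSYTᵇ t = allᵇ weaklyIncᵇ t ∧ colStrictᵇ t

countℕ : ℕ → List ℕ → ℕ
countℕ k [] = 0
countℕ k (a ∷ xs) = (if a ≡ᵇ k then 1 else 0) ℕ.+ countℕ k xs

content : (n : ℕ) → List (List ℕ) → Monomial n
content n t = V.tabulate (λ k → countℕ (toℕ k) (L.concat t))

schur : (n : ℕ) → Vec ℕ n → Poly n
schur n λ' = map (λ t → (+ 1 , content n t)) (filterᵇ isSSYTᵇ (fillings n (V.toList λ')))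

-- Partitions with at most n parts, written as weakly decreasing vectors
-- (λ_1,...,λ_n) of length n padded with zeros.

data Decreasing : List ℕ → Set where
  []  : Decreasing []
  [_] : ∀ a → Decreasing (a ∷ [])
  _∷_ : ∀ {a b xs} → b ≤ a → Decreasing (b ∷ xs) → Decreasing (a ∷ b ∷ xs)

IsPartition : ∀ {n} → Vec ℕ n → Set
IsPartition λ' = Decreasing (V.toList λ')

decreasingᵇ : List ℕ → Bool
decreasingᵇ [] = true
decreasingᵇ (a ∷ []) = true
decreasingᵇ (a ∷ b ∷ xs) = (b ≤ᵇ a) ∧ decreasingᵇ (b ∷ xs)

len : ∀ {n} → Vec ℕ n → ℕ
len [] = 0
len (zero ∷ xs) = len xs
len (suc _ ∷ xs) = suc (len xs)

boundedVecs : (n b : ℕ) → List (Vec ℕ n)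
boundedVecs zero b = [] ∷ []
boundedVecs (suc n) b = concatMap (λ a → map (a ∷_) (boundedVecs n b)) (upTo (suc b))

partitions : (n N : ℕ) → List (Vec ℕ n)
partitions n N = filterᵇ (λ μ → decreasingᵇ (V.toList μ) ∧ (V.sum μ ≡ᵇ N)) (boundedVecs n N)

schurExpansion : (n N : ℕ) → (Vec ℕ n → ℤ) → Poly n
schurExpansion n N c = concatMap (λ μ → scale (c μ) (schur n μ)) (partitions n N)

-- Write a_δ² = Σ_ν c_ν s_ν. Among the partitions ν with c_ν ≠ 0 and
-- ν₁ + ⋯ + ν_i ≥ λ₁ + ⋯ + λ_i (λ itself is one), pick μ maximising Φ ν = Σ_k (ν₁ + ⋯ + ν_k).
-- Every monomial of s_ν is dominated by ν (it is the content of a semistandard tableau of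
-- shape ν) and x^μ occurs in s_μ; as Φ is strictly monotone for dominance, triangularity
-- shows that x^μ has nonzero coefficient in a_δ². On the other hand each factor x_a - x_b
-- (a < b) of a_δ contributes at most [a < i] to the sum of the first i exponents, so every
-- monomial x^e of a_δ² has e₁ + ⋯ + e_i ≤ 2·#{a < b < n : a < i} = 2ni - i² - i. Hence
--   i(2n - m - 1) = λ₁ + ⋯ + λ_i ≤ μ₁ + ⋯ + μ_i ≤ 2ni - i² - i,   i.e.  i ≤ m.
module Submission where

open import Defs
open import Data.Nat as ℕ using (ℕ; zero; suc; _≤_; _<_; _+_; _*_; _∸_; z≤n; s≤s; _≤ᵇ_; _<ᵇ_; _≡ᵇ_)
import Data.Nat.Properties as ℕP
open import Data.Nat.ListAction using () renaming (sum to sumℕ)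
import Data.Nat.ListAction.Properties as ΣP
open import Data.Nat.Tactic.RingSolver using (solve-∀)
open import Algebra.Properties.CommutativeSemigroup ℕP.+-commutativeSemigroup using (interchange)
open import Data.Integer as ℤ using (ℤ; +_)
import Data.Integer.Properties as ℤP
open import Data.List as L using (List; []; _∷_; _++_; concatMap; map; foldr; allFin; length; zip; concat; replicate; filter)
import Data.List.Properties as LP
open import Data.List.Relation.Unary.All as All using (All; []; _∷_)
import Data.List.Relation.Unary.All.Properties as AllP
open import Data.List.Relation.Unary.Any as Any using (Any; here; there)
import Data.List.Relation.Unary.Any.Properties as AnyP
open import Data.List.Membership.Propositional using (_∈_; find; lose)
open import Data.List.Membership.Propositional.Properties using (∈-map⁺; ∈-concatMap⁺; ∈-upTo⁺; ∈-filter⁺; ∈-filter⁻)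
open import Data.List.Relation.Binary.Pointwise using (Pointwise; []; _∷_)
open import Data.List.Extrema.Nat using (argmax; argmax-all; argmax-sel; f[xs]≤f[argmax])
open import Data.Vec as V using (Vec; []; _∷_; lookup; sum; toList)
import Data.Vec.Properties as VP
open import Data.Fin as F using (Fin; toℕ)
open import Data.Bool using (Bool; true; false; if_then_else_; T; _∧_)
open import Data.Bool.Properties using (T-∧)
open import Data.Unit using (tt)
open import Data.Empty using (⊥-elim)
open import Data.Product using (∃; _×_; _,_; proj₁; proj₂)
import Data.Product as Product
open import Data.Sum using (_⊎_; inj₁; inj₂)
open import Function using (Equivalence)
open import Relation.Nullary using (yes; no)
open import Relation.Nullary.Decidable using (⌊_⌋; ⌊⌋-map′; _×-dec_; ¬?)
open import Relation.Unary using (Decidable)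
open import Relation.Binary.PropositionalEquality

T-∧⁻ : ∀ {a b} → T (a ∧ b) → T a × T b
T-∧⁻ = Equivalence.to T-∧

T-∧⁺ : ∀ {a b} → T a → T b → T (a ∧ b)
T-∧⁺ p q = Equivalence.from T-∧ (p , q)

All-concatMap⁺ : ∀ {A B : Set} {P : B → Set} (f : A → List B) {xs} → All (λ x → All P (f x)) xs → All P (concatMap f xs)
All-concatMap⁺ f ps = AllP.concat⁺ (AllP.map⁺ ps)

∈-concatMap⁺′ : ∀ {A B : Set} (f : A → List B) {x y xs} → x ∈ xs → y ∈ f x → y ∈ concatMap f xs
∈-concatMap⁺′ f x∈ y∈ = ∈-concatMap⁺ f (lose x∈ y∈)

coeff-++ : ∀ {n} (p q : Poly n) e → coeff (p ++ q) e ≡ coeff p e ℤ.+ coeff q e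
coeff-++ [] q e = sym (ℤP.+-identityˡ _)
coeff-++ ((a , f) ∷ p) q e rewrite coeff-++ p q e =
  sym (ℤP.+-assoc (if ⌊ VP.≡-dec ℕ._≟_ f e ⌋ then a else + 0) (coeff p e) (coeff q e))

coeff-scale : ∀ {n} c (p : Poly n) e → coeff (scale c p) e ≡ c ℤ.* coeff p e
coeff-scale c [] e = sym (ℤP.*-zeroʳ c)
coeff-scale c ((a , f) ∷ p) e = begin
  (if b then c ℤ.* a else + 0) ℤ.+ coeff (scale c p) e
    ≡⟨ cong₂ ℤ._+_ (scale-if b) (coeff-scale c p e) ⟩
  c ℤ.* (if b then a else + 0) ℤ.+ c ℤ.* coeff p e
    ≡⟨ ℤP.*-distribˡ-+ c (if b then a else + 0) (coeff p e) ⟨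
  c ℤ.* ((if b then a else + 0) ℤ.+ coeff p e) ∎
  where
  open ≡-Reasoning
  b = ⌊ VP.≡-dec ℕ._≟_ f e ⌋
  scale-if : ∀ b → (if b then c ℤ.* a else + 0) ≡ c ℤ.* (if b then a else + 0)
  scale-if true = refl
  scale-if false = sym (ℤP.*-zeroʳ c)

sumℤ : List ℤ → ℤ
sumℤ = foldr ℤ._+_ (+ 0)

coeff-concatMap : ∀ {n} {A : Set} (f : A → Poly n) (xs : List A) e →
  coeff (concatMap f xs) e ≡ sumℤ (map (λ x → coeff (f x) e) xs)
coeff-concatMap f [] e = refl
coeff-concatMap f (x ∷ xs) e =
  trans (coeff-++ (f x) (concatMap f xs) e) (cong (λ s → coeff (f x) e ℤ.+ s) (coeff-concatMap f xs e))

_occursIn_ : ∀ {n} → Monomial n → Poly n → Set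
e occursIn p = Any (λ t → proj₂ t ≡ e) p

occurs-if-coeff≢0 : ∀ {n} (p : Poly n) e → coeff p e ≢ + 0 → e occursIn p
occurs-if-coeff≢0 [] e c≢0 = ⊥-elim (c≢0 refl)
occurs-if-coeff≢0 ((a , f) ∷ p) e c≢0 with VP.≡-dec ℕ._≟_ f e
... | yes f≡e = here f≡e
... | no _ = there (occurs-if-coeff≢0 p e (λ c≡0 → c≢0 (trans (ℤP.+-identityˡ _) c≡0)))

-- Sum of the first k entries of an exponent vector (all of them if k exceeds the length).
prefixSum : ∀ {n} → ℕ → Vec ℕ n → ℕ
prefixSum zero _ = 0
prefixSum (suc k) [] = 0
prefixSum (suc k) (x ∷ xs) = x + prefixSum k xs

prefixSum-zipWith : ∀ {n} k (e f : Vec ℕ n) →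
  prefixSum k (V.zipWith _+_ e f) ≡ prefixSum k e + prefixSum k f
prefixSum-zipWith zero e f = refl
prefixSum-zipWith (suc k) [] [] = refl
prefixSum-zipWith (suc k) (x ∷ e) (y ∷ f) rewrite prefixSum-zipWith k e f =
  interchange x y (prefixSum k e) (prefixSum k f)

Bounded : ∀ {n} → ℕ → ℕ → Poly n → Set
Bounded k B p = All (λ t → prefixSum k (proj₂ t) ≤ B) p

Bounded-occurs : ∀ {n} k {B} {p : Poly n} {e} → Bounded k B p → e occursIn p → prefixSum k e ≤ B
Bounded-occurs k (b ∷ _) (here refl) = b
Bounded-occurs k (_ ∷ bs) (there o) = Bounded-occurs k bs o

Bounded-⊗ : ∀ {n} k A B (p q : Poly n) → Bounded k A p → Bounded k B q → Bounded k (A + B) (p ⊗ q)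
Bounded-⊗ k A B [] q [] bq = []
Bounded-⊗ k A B ((a , e) ∷ p) q (be ∷ bp) bq = AllP.++⁺ (times-term q bq) (Bounded-⊗ k A B p q bp bq)
  where
  times-term : (q' : Poly _) → Bounded k B q' →
    Bounded k (A + B) (map (λ { (b , f) → (a ℤ.* b , V.zipWith _+_ e f) }) q')
  times-term [] [] = []
  times-term ((b , f) ∷ q') (bf ∷ bq') =
    subst (_≤ A + B) (sym (prefixSum-zipWith k e f)) (ℕP.+-mono-≤ be bf) ∷ times-term q' bq'

Bounded-neg : ∀ {n} k {B} (p : Poly n) → Bounded k B p → Bounded k B (neg p)
Bounded-neg k [] [] = []
Bounded-neg k (_ ∷ p) (b ∷ bs) = b ∷ Bounded-neg k p bs

isBelow : ℕ → ℕ → ℕ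
isBelow x k = if x <ᵇ k then 1 else 0

isBelow-antitone : ∀ x y k → x < y → isBelow y k ≤ isBelow x k
isBelow-antitone x y zero _ = z≤n
isBelow-antitone zero y (suc k) _ with y <ᵇ suc k
... | true = ℕP.≤-refl
... | false = z≤n
isBelow-antitone (suc x) (suc y) (suc k) (s≤s x<y) = isBelow-antitone x y k x<y

prefixSum-zeros : ∀ {n} k → prefixSum k (V.replicate n 0) ≡ 0
prefixSum-zeros zero = refl
prefixSum-zeros {zero} (suc k) = refl
prefixSum-zeros {suc n} (suc k) = prefixSum-zeros {n} k

unit : ∀ {n} → Fin n → Vec ℕ n
unit i = V.tabulate (λ j → if ⌊ j F.≟ i ⌋ then 1 else 0)

prefixSum-unit : ∀ {n} (i : Fin n) k → prefixSum k (unit i) ≡ isBelow (toℕ i) k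
prefixSum-unit i zero = refl
prefixSum-unit F.zero (suc k) = cong suc (prefixSum-tail k)
  where
  prefixSum-tail : ∀ {m} k → prefixSum k (V.tabulate {n = m} (λ j → if ⌊ F.suc j F.≟ F.zero ⌋ then 1 else 0)) ≡ 0
  prefixSum-tail zero = refl
  prefixSum-tail {zero} (suc k) = refl
  prefixSum-tail {suc m} (suc k) = prefixSum-tail {m} k
prefixSum-unit (F.suc i) (suc k) = trans (cong (prefixSum k) (VP.tabulate-cong shift)) (prefixSum-unit i k)
  where
  shift : ∀ j → (if ⌊ F.suc j F.≟ F.suc i ⌋ then 1 else 0) ≡ (if ⌊ j F.≟ i ⌋ then 1 else 0)
  shift j = cong (λ b → if b then 1 else 0) (⌊⌋-map′ _ _ (j F.≟ i))

-- The two monomials x_a, x_b of a factor x_a - x_b with a < b have k-th prefix sums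
-- [a < k] and [b < k] ≤ [a < k].
Bounded-factor : ∀ {n} k (a b : Fin n) → toℕ a < toℕ b → Bounded k (isBelow (toℕ a) k) (var a ⊕ neg (var b))
Bounded-factor k a b a<b = AllP.++⁺ (bound-var a ℕP.≤-refl)
  (Bounded-neg k (var b) (bound-var b (isBelow-antitone (toℕ a) (toℕ b) k a<b)))
  where
  bound-var : ∀ i → isBelow (toℕ i) k ≤ isBelow (toℕ a) k → Bounded k (isBelow (toℕ a) k) (var i)
  bound-var i le = ℕP.≤-trans (ℕP.≤-reflexive (prefixSum-unit i k)) le ∷ []

Ordered : ∀ {n} → Fin n × Fin n → Set
Ordered (i , j) = toℕ i < toℕ j

leftBelow : ∀ {n} → ℕ → Fin n × Fin n → ℕ
leftBelow k (i , j) = isBelow (toℕ i) k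

Bounded-product : ∀ {n} k (ps : List (Fin n × Fin n)) → All Ordered ps →
  Bounded k (sumℕ (map (leftBelow k) ps)) (foldr (λ { (i , j) acc → (var i ⊕ neg (var j)) ⊗ acc }) one ps)
Bounded-product {n} k [] [] = ℕP.≤-reflexive (prefixSum-zeros {n} k) ∷ []
Bounded-product k ((a , b) ∷ ps) (a<b ∷ ord) =
  Bounded-⊗ k _ _ (var a ⊕ neg (var b)) _ (Bounded-factor k a b a<b) (Bounded-product k ps ord)

pairs-ordered : ∀ n → All Ordered (pairs n)
pairs-ordered n = All-concatMap⁺ _ (AllP.tabulate⁺ (λ i → All-concatMap⁺ _ (AllP.tabulate⁺ (λ j → ordered-if i j))))
  where
  ordered-if : ∀ (i j : Fin n) → All Ordered (if toℕ i <ᵇ toℕ j then (i , j) ∷ [] else [])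
  ordered-if i j with toℕ i <ᵇ toℕ j in eq
  ... | true = ℕP.<ᵇ⇒< (toℕ i) (toℕ j) (subst T (sym eq) tt) ∷ []
  ... | false = []

sumBelow : ℕ → (ℕ → ℕ) → ℕ
sumBelow zero f = 0
sumBelow (suc N) f = f 0 + sumBelow N (λ x → f (suc x))

sumBelow-cong : ∀ N {f g : ℕ → ℕ} → (∀ x → f x ≡ g x) → sumBelow N f ≡ sumBelow N g
sumBelow-cong zero eq = refl
sumBelow-cong (suc N) eq = cong₂ _+_ (eq 0) (sumBelow-cong N (λ x → eq (suc x)))

sumBelow-above : ∀ N y c → sumBelow N (λ x → if y <ᵇ x then c else 0) ≡ (N ∸ suc y) * c
sumBelow-above zero y c = refl
sumBelow-above (suc N) zero c = sumBelow-const N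
  where
  sumBelow-const : ∀ N → sumBelow N (λ _ → c) ≡ N * c
  sumBelow-const zero = refl
  sumBelow-const (suc N) = cong (ℕ._+_ c) (sumBelow-const N)
sumBelow-above (suc N) (suc y) c = sumBelow-above N y c

sumBelow-truncate : ∀ N k (f : ℕ → ℕ) → k ≤ N → sumBelow N (λ x → if x <ᵇ k then f x else 0) ≡ sumBelow k f
sumBelow-truncate N zero f _ = sumBelow-zero N
  where
  sumBelow-zero : ∀ N → sumBelow N (λ _ → 0) ≡ 0
  sumBelow-zero zero = refl
  sumBelow-zero (suc N) = sumBelow-zero N
sumBelow-truncate (suc N) (suc k) f (s≤s k≤N) = cong (ℕ._+_ (f 0)) (sumBelow-truncate N k (λ x → f (suc x)) k≤N)

sum-concatMap : ∀ {A B : Set} (f : B → ℕ) (g : A → List B) xs →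
  sumℕ (map f (concatMap g xs)) ≡ sumℕ (map (λ x → sumℕ (map f (g x))) xs)
sum-concatMap f g [] = refl
sum-concatMap f g (x ∷ xs) = begin
  sumℕ (map f (g x ++ concatMap g xs))                       ≡⟨ cong sumℕ (LP.map-++ f (g x) _) ⟩
  sumℕ (map f (g x) ++ map f (concatMap g xs))               ≡⟨ ΣP.sum-++ (map f (g x)) _ ⟩
  sumℕ (map f (g x)) + sumℕ (map f (concatMap g xs))         ≡⟨ cong (ℕ._+_ (sumℕ (map f (g x)))) (sum-concatMap f g xs) ⟩
  sumℕ (map f (g x)) + sumℕ (map (λ x → sumℕ (map f (g x))) xs) ∎
  where open ≡-Reasoning

sum-tabulate : ∀ {A : Set} n (f : Fin n → A) (g : A → ℕ) (h : ℕ → ℕ) →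
  (∀ i → g (f i) ≡ h (toℕ i)) → sumℕ (map g (L.tabulate f)) ≡ sumBelow n h
sum-tabulate zero f g h eq = refl
sum-tabulate (suc n) f g h eq = cong₂ _+_ (eq F.zero) (sum-tabulate n (λ i → f (F.suc i)) g (λ x → h (suc x)) (λ i → eq (F.suc i)))

-- pairsBelow k n = #{(a , b) : a < b < n, a < k} = Σ_{a<k} (n - 1 - a).
pairsBelow : ℕ → ℕ → ℕ
pairsBelow k n = sumBelow k (λ a → n ∸ suc a)

pairs-count : ∀ n k → k ≤ n → sumℕ (map (leftBelow k) (pairs n)) ≡ pairsBelow k n
pairs-count n k k≤n = begin
  sumℕ (map (leftBelow k) (pairs n))
    ≡⟨ sum-concatMap (leftBelow k) _ (allFin n) ⟩
  sumℕ (map (λ i → sumℕ (map (leftBelow k) (row i))) (allFin n))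
    ≡⟨ sum-tabulate n (λ i → i) _ (λ x → (n ∸ suc x) * isBelow x k) row-count ⟩
  sumBelow n (λ x → (n ∸ suc x) * isBelow x k)
    ≡⟨ sumBelow-cong n restrict ⟩
  sumBelow n (λ x → if x <ᵇ k then n ∸ suc x else 0)
    ≡⟨ sumBelow-truncate n k (λ a → n ∸ suc a) k≤n ⟩
  pairsBelow k n ∎
  where
  open ≡-Reasoning
  row : Fin n → List (Fin n × Fin n)
  row i = concatMap (λ j → if toℕ i <ᵇ toℕ j then (i , j) ∷ [] else []) (allFin n)
  entry : ∀ (i j : Fin n) → sumℕ (map (leftBelow k) (if toℕ i <ᵇ toℕ j then (i , j) ∷ [] else []))
                         ≡ (if toℕ i <ᵇ toℕ j then isBelow (toℕ i) k else 0)
  entry i j with toℕ i <ᵇ toℕ j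
  ... | true = ℕP.+-identityʳ _
  ... | false = refl
  row-count : ∀ i → sumℕ (map (leftBelow k) (row i)) ≡ (n ∸ suc (toℕ i)) * isBelow (toℕ i) k
  row-count i = trans (sum-concatMap (leftBelow k) _ (allFin n))
    (trans (sum-tabulate n (λ j → j) _ _ (entry i)) (sumBelow-above n (toℕ i) (isBelow (toℕ i) k)))
  restrict : ∀ x → (n ∸ suc x) * isBelow x k ≡ (if x <ᵇ k then n ∸ suc x else 0)
  restrict x with x <ᵇ k
  ... | true = ℕP.*-identityʳ _
  ... | false = ℕP.*-zeroʳ (n ∸ suc x)

pairsBelow-closed : ∀ k n → k ≤ n → 2 * pairsBelow k n + k * k + k ≡ 2 * n * k
pairsBelow-closed zero n _ = sym (ℕP.*-zeroʳ (2 * n))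
pairsBelow-closed (suc k) (suc n) (s≤s k≤n) = begin
  2 * (n + S) + suc k * suc k + suc k    ≡⟨ expand k n S ⟩
  (2 * S + k * k + k) + 2 * n + 2 * k + 2 ≡⟨ cong (λ z → z + 2 * n + 2 * k + 2) (pairsBelow-closed k n k≤n) ⟩
  2 * n * k + 2 * n + 2 * k + 2          ≡⟨ collect k n ⟩
  2 * suc n * suc k ∎
  where
  open ≡-Reasoning
  S : ℕ
  S = pairsBelow k n
  expand : ∀ k n S → 2 * (n + S) + suc k * suc k + suc k ≡ 2 * S + k * k + k + 2 * n + 2 * k + 2
  expand = solve-∀
  collect : ∀ k n → 2 * n * k + 2 * n + 2 * k + 2 ≡ 2 * suc n * suc k
  collect = solve-∀

vandermonde²-bound : ∀ n k → k ≤ n → (e : Monomial n) →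
  coeff (vandermonde n ⊗ vandermonde n) e ≢ + 0 → prefixSum k e + k * k + k ≤ 2 * n * k
vandermonde²-bound n k k≤n e c≢0 = begin
  prefixSum k e + k * k + k                    ≤⟨ ℕP.+-monoˡ-≤ k (ℕP.+-monoˡ-≤ (k * k) e-bound) ⟩
  sumℕ (map (leftBelow k) (pairs n)) + sumℕ (map (leftBelow k) (pairs n)) + k * k + k
    ≡⟨ cong (λ z → z + k * k + k) (trans (cong₂ _+_ (pairs-count n k k≤n) (pairs-count n k k≤n)) (double (pairsBelow k n))) ⟩
  2 * pairsBelow k n + k * k + k               ≡⟨ pairsBelow-closed k n k≤n ⟩
  2 * n * k ∎
  where
  open ℕP.≤-Reasoning
  Bounded-a : Bounded k (sumℕ (map (leftBelow k) (pairs n))) (vandermonde n)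
  Bounded-a = Bounded-product k (pairs n) (pairs-ordered n)
  e-bound : prefixSum k e ≤ sumℕ (map (leftBelow k) (pairs n)) + sumℕ (map (leftBelow k) (pairs n))
  e-bound = Bounded-occurs k (Bounded-⊗ k _ _ (vandermonde n) (vandermonde n) Bounded-a Bounded-a)
                              (occurs-if-coeff≢0 _ e c≢0)
  double : ∀ s → s + s ≡ 2 * s
  double = solve-∀

HasShape : List (List ℕ) → List ℕ → Set
HasShape = Pointwise (λ row l → length row ≡ l)

words-length : ∀ n k → All (λ w → length w ≡ k) (words n k)
words-length n zero = refl ∷ []
words-length n (suc k) =
  All-concatMap⁺ _ (AllP.applyUpTo⁺₂ _ n (λ a → AllP.map⁺ (All.map (cong suc) (words-length n k))))

fillings-shape : ∀ n ls → All (λ t → HasShape t ls) (fillings n ls)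
fillings-shape n [] = [] ∷ []
fillings-shape n (l ∷ ls) =
  All-concatMap⁺ _ (All.map (λ len≡l → AllP.map⁺ (All.map (len≡l ∷_) (fillings-shape n ls))) (words-length n l))

data EntriesFrom : ℕ → List (List ℕ) → Set where
  [] : ∀ {r} → EntriesFrom r []
  _∷_ : ∀ {r row t} → All (r ≤_) row → EntriesFrom (suc r) t → EntriesFrom r (row ∷ t)

weaklyInc-head : ∀ b bs → T (weaklyIncᵇ (b ∷ bs)) → All (b ≤_) (b ∷ bs)
weaklyInc-head b [] _ = ℕP.≤-refl ∷ []
weaklyInc-head b (c ∷ cs) inc with T-∧⁻ {b ≤ᵇ c} inc
... | b≤c , inc' = ℕP.≤-refl ∷ All.map (ℕP.≤-trans (ℕP.≤ᵇ⇒≤ b c b≤c)) (weaklyInc-head c cs inc')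

-- If row has entries ≥ r, the next (not longer) row lies strictly below it column by column
-- and is weakly increasing, then its entries are ≥ r + 1: they dominate its first entry,
-- which exceeds the first entry of row.
nextRow-from : ∀ r row row' → length row' ≤ length row → All (r ≤_) row →
  T (allᵇ (λ { (a , b) → a <ᵇ b }) (zip row row')) → T (weaklyIncᵇ row') → All (suc r ≤_) row'
nextRow-from r row [] _ _ _ _ = []
nextRow-from r (a ∷ as) (b ∷ bs) _ (r≤a ∷ _) strict inc =
  All.map (ℕP.≤-trans (ℕP.≤-trans (s≤s r≤a) (ℕP.<ᵇ⇒< a b (proj₁ (T-∧⁻ {a <ᵇ b} strict))))) (weaklyInc-head b bs inc)

rows-entriesFrom : ∀ r row t l ls → HasShape (row ∷ t) (l ∷ ls) → Decreasing (l ∷ ls) →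
  T (allᵇ weaklyIncᵇ (row ∷ t)) → T (colStrictᵇ (row ∷ t)) → All (r ≤_) row → EntriesFrom r (row ∷ t)
rows-entriesFrom r row [] _ _ _ _ _ _ r≤row = r≤row ∷ []
rows-entriesFrom r row (row' ∷ t) l (l' ∷ ls) (len ∷ len' ∷ shape) (l'≤l ∷ dec) inc strict r≤row
  with T-∧⁻ {weaklyIncᵇ row} inc | T-∧⁻ {allᵇ (λ { (a , b) → a <ᵇ b }) (zip row row')} strict
... | _ , inc' | strict₁ , strict' = r≤row ∷ rows-entriesFrom (suc r) row' t l' ls (len' ∷ shape) dec inc' strict'
      (nextRow-from r row row' shorter r≤row strict₁ (proj₁ (T-∧⁻ {weaklyIncᵇ row'} inc')))
  where
  shorter : length row' ≤ length row
  shorter = subst₂ _≤_ (sym len') (sym len) l'≤l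

ssyt-entriesFrom : ∀ t ls → HasShape t ls → Decreasing ls → T (isSSYTᵇ t) → EntriesFrom 0 t
ssyt-entriesFrom [] _ _ _ _ = []
ssyt-entriesFrom (row ∷ t) (l ∷ ls) shape dec ssyt with T-∧⁻ {allᵇ weaklyIncᵇ (row ∷ t)} ssyt
... | inc , strict = rows-entriesFrom 0 row t l ls shape dec inc strict (All.universal (λ _ → z≤n) row)

countBelow : ℕ → List ℕ → ℕ
countBelow k [] = 0
countBelow k (x ∷ xs) = isBelow x k + countBelow k xs

countBelow-++ : ∀ k xs ys → countBelow k (xs ++ ys) ≡ countBelow k xs + countBelow k ys
countBelow-++ k [] ys = refl
countBelow-++ k (x ∷ xs) ys = trans (cong (ℕ._+_ (isBelow x k)) (countBelow-++ k xs ys)) (sym (ℕP.+-assoc (isBelow x k) _ _))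

countBelow-none : ∀ r k row → All (r ≤_) row → k ≤ r → countBelow k row ≡ 0
countBelow-none r k [] [] _ = refl
countBelow-none r k (x ∷ row) (r≤x ∷ r≤row) k≤r =
  cong₂ _+_ (not-below x k (ℕP.≤-trans k≤r r≤x)) (countBelow-none r k row r≤row k≤r)
  where
  not-below : ∀ x k → k ≤ x → isBelow x k ≡ 0
  not-below x zero _ = refl
  not-below (suc x) (suc k) (s≤s k≤x) = not-below x k k≤x

countBelow-length : ∀ k row → countBelow k row ≤ length row
countBelow-length k [] = z≤n
countBelow-length k (x ∷ row) = ℕP.+-mono-≤ (isBelow≤1 x k) (countBelow-length k row)
  where
  isBelow≤1 : ∀ x k → isBelow x k ≤ 1
  isBelow≤1 x k with x <ᵇ k
  ... | true = ℕP.≤-refl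
  ... | false = z≤n

-- Entries < k of a tableau whose row j has entries ≥ r + j lie in its first k - r rows,
-- so there are at most ν₁ + ⋯ + ν_{k-r} of them.
countBelow-shape : ∀ {m} r k t (ν : Vec ℕ m) → EntriesFrom r t → HasShape t (toList ν) →
  countBelow k (concat t) ≤ prefixSum (k ∸ r) ν
countBelow-shape r k [] [] [] [] = z≤n
countBelow-shape r k (row ∷ t) (l ∷ ν) (r≤row ∷ from) (len ∷ shape)
  rewrite countBelow-++ k row (concat t) with ℕP.≤-<-connex k r
-- a row with entries ≥ r ≥ k contributes nothing, and k ∸ r = 0
... | inj₁ k≤r rewrite countBelow-none r k row r≤row k≤r | ℕP.m≤n⇒m∸n≡0 k≤r =
  ℕP.≤-trans (countBelow-shape (suc r) k t ν from shape)
    (ℕP.≤-reflexive (cong (λ j → prefixSum j ν) (ℕP.m≤n⇒m∸n≡0 (ℕP.m≤n⇒m≤1+n k≤r))))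
-- here k ∸ r = 1 + (k ∸ (r + 1)): row r contributes at most its length ν_{r+1}
... | inj₂ r<k rewrite ℕP.+-∸-assoc 1 r<k =
  ℕP.+-mono-≤ (subst (countBelow k row ≤_) len (countBelow-length k row)) (countBelow-shape (suc r) k t ν from shape)

countBelow-suc : ∀ b xs → countℕ b xs + countBelow b xs ≡ countBelow (suc b) xs
countBelow-suc b [] = refl
countBelow-suc b (x ∷ xs) = trans (interchange (if x ≡ᵇ b then 1 else 0) (countℕ b xs) (isBelow x b) (countBelow b xs))
  (cong₂ _+_ (isBelow-suc x b) (countBelow-suc b xs))
  where
  isBelow-suc : ∀ x b → (if x ≡ᵇ b then 1 else 0) + isBelow x b ≡ isBelow x (suc b)
  isBelow-suc zero zero = refl
  isBelow-suc zero (suc b) = refl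
  isBelow-suc (suc x) zero = refl
  isBelow-suc (suc x) (suc b) = isBelow-suc x b

countBelow-mono : ∀ b c xs → b ≤ c → countBelow b xs ≤ countBelow c xs
countBelow-mono b c [] _ = z≤n
countBelow-mono b c (x ∷ xs) b≤c = ℕP.+-mono-≤ (isBelow-mono x b c b≤c) (countBelow-mono b c xs b≤c)
  where
  isBelow-mono : ∀ x b c → b ≤ c → isBelow x b ≤ isBelow x c
  isBelow-mono x zero c _ = z≤n
  isBelow-mono zero (suc b) (suc c) _ = ℕP.≤-refl
  isBelow-mono (suc x) (suc b) (suc c) (s≤s b≤c) = isBelow-mono x b c b≤c

-- The first k multiplicities of letters b, b+1, … add up to at most the number of entries
-- in [b, b + k); stated with the entries below b added on both sides.
prefixSum-multiplicities : ∀ n b k (f : Fin n → ℕ) xs → (∀ j → f j ≡ countℕ (b + toℕ j) xs) →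
  prefixSum k (V.tabulate f) + countBelow b xs ≤ countBelow (b + k) xs
prefixSum-multiplicities n b zero f xs _ = ℕP.≤-reflexive (cong (λ c → countBelow c xs) (sym (ℕP.+-identityʳ b)))
prefixSum-multiplicities zero b (suc k) f xs _ = countBelow-mono b (b + suc k) xs (ℕP.m≤m+n b (suc k))
prefixSum-multiplicities (suc n) b (suc k) f xs f≡count = begin
  f F.zero + P + countBelow b xs           ≡⟨ cong (λ c → c + P + countBelow b xs) first ⟩
  countℕ b xs + P + countBelow b xs        ≡⟨ regroup (countℕ b xs) P (countBelow b xs) ⟩
  P + (countℕ b xs + countBelow b xs)      ≡⟨ cong (ℕ._+_ P) (countBelow-suc b xs) ⟩
  P + countBelow (suc b) xs                ≤⟨ prefixSum-multiplicities n (suc b) k (λ j → f (F.suc j)) xs shifted ⟩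
  countBelow (suc b + k) xs                ≡⟨ cong (λ c → countBelow c xs) (sym (ℕP.+-suc b k)) ⟩
  countBelow (b + suc k) xs ∎
  where
  open ℕP.≤-Reasoning
  P : ℕ
  P = prefixSum k (V.tabulate (λ j → f (F.suc j)))
  regroup : ∀ a p c → a + p + c ≡ p + (a + c)
  regroup = solve-∀
  first : f F.zero ≡ countℕ b xs
  first = trans (f≡count F.zero) (cong (λ c → countℕ c xs) (ℕP.+-identityʳ b))
  shifted : ∀ j → f (F.suc j) ≡ countℕ (suc b + toℕ j) xs
  shifted j = trans (f≡count (F.suc j)) (cong (λ c → countℕ c xs) (ℕP.+-suc b (toℕ j)))

_⊵_ : ∀ {n} → Vec ℕ n → Vec ℕ n → Set
ν ⊵ μ = ∀ k → prefixSum k μ ≤ prefixSum k ν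

ssyt-content-dominated : ∀ n (ν : Vec ℕ n) t → IsPartition ν → HasShape t (toList ν) → T (isSSYTᵇ t) →
  ν ⊵ content n t
ssyt-content-dominated n ν t dec shape ssyt k = begin
  prefixSum k (content n t)                    ≤⟨ ℕP.m≤m+n _ (countBelow 0 xs) ⟩
  prefixSum k (content n t) + countBelow 0 xs  ≤⟨ prefixSum-multiplicities n 0 k _ xs (λ j → refl) ⟩
  countBelow k xs                              ≤⟨ countBelow-shape 0 k t ν (ssyt-entriesFrom t (toList ν) shape dec ssyt) shape ⟩
  prefixSum k ν ∎
  where
  open ℕP.≤-Reasoning
  xs : List ℕ
  xs = concat t

∈-filterᵇ⁺ : ∀ {A : Set} (p : A → Bool) {x} xs → x ∈ xs → T (p x) → x ∈ filterᵇ p xs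
∈-filterᵇ⁺ p (y ∷ xs) x∈ px with p y in eq
∈-filterᵇ⁺ p (y ∷ xs) (here refl) px | true = here refl
∈-filterᵇ⁺ p (y ∷ xs) (there x∈) px | true = there (∈-filterᵇ⁺ p xs x∈ px)
∈-filterᵇ⁺ p (y ∷ xs) (here refl) px | false = ⊥-elim (subst T eq px)
∈-filterᵇ⁺ p (y ∷ xs) (there x∈) px | false = ∈-filterᵇ⁺ p xs x∈ px

∈-filterᵇ⁻ : ∀ {A : Set} (p : A → Bool) {x} xs → x ∈ filterᵇ p xs → x ∈ xs × T (p x)
∈-filterᵇ⁻ p (y ∷ xs) x∈ with p y in eq
∈-filterᵇ⁻ p (y ∷ xs) (here refl) | true = here refl , subst T (sym eq) tt
∈-filterᵇ⁻ p (y ∷ xs) (there x∈) | true = Product.map₁ there (∈-filterᵇ⁻ p xs x∈)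
∈-filterᵇ⁻ p (y ∷ xs) x∈ | false = Product.map₁ there (∈-filterᵇ⁻ p xs x∈)

schur-support : ∀ n (ν : Vec ℕ n) e → coeff (schur n ν) e ≢ + 0 →
  ∃ λ t → HasShape t (toList ν) × T (isSSYTᵇ t) × content n t ≡ e
schur-support n ν e c≢0 with find (AnyP.map⁻ (occurs-if-coeff≢0 (schur n ν) e c≢0))
... | t , t∈ssyt , content≡e with ∈-filterᵇ⁻ isSSYTᵇ _ t∈ssyt
...   | t∈fillings , ssyt = t , All.lookup (fillings-shape n (toList ν)) t∈fillings , ssyt , content≡e

schur-dominated : ∀ n (ν : Vec ℕ n) e → IsPartition ν → coeff (schur n ν) e ≢ + 0 → ν ⊵ e
schur-dominated n ν e dec c≢0 with schur-support n ν e c≢0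
... | t , shape , ssyt , refl = ssyt-content-dominated n ν t dec shape ssyt

coeff-unitTerms : ∀ {n} (p : Poly n) e → All (λ term → proj₁ term ≡ + 1) p →
  ∃ λ k → coeff p e ≡ + k × (e occursIn p → 1 ≤ k)
coeff-unitTerms [] e [] = 0 , refl , λ ()
coeff-unitTerms ((a , f) ∷ p) e (refl ∷ units) with coeff-unitTerms p e units | VP.≡-dec ℕ._≟_ f e
... | k , c≡k , _ | yes f≡e = suc k , cong (ℤ._+_ (+ 1)) c≡k , λ _ → s≤s z≤n
... | k , c≡k , pos | no f≢e = k , trans (ℤP.+-identityˡ _) c≡k , λ { (here f≡e) → ⊥-elim (f≢e f≡e) ; (there o) → pos o }

superstandard : ℕ → List ℕ → List (List ℕ)
superstandard b [] = []
superstandard b (l ∷ ls) = replicate l b ∷ superstandard (suc b) ls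

replicate-word : ∀ n b → b < n → ∀ l → replicate l b ∈ words n l
replicate-word n b b<n zero = here refl
replicate-word n b b<n (suc l) = ∈-concatMap⁺′ _ (∈-upTo⁺ b<n) (∈-map⁺ (b ∷_) (replicate-word n b b<n l))

superstandard-filling : ∀ n b ls → b + length ls ≤ n → superstandard b ls ∈ fillings n ls
superstandard-filling n b [] _ = here refl
superstandard-filling n b (l ∷ ls) fits =
  ∈-concatMap⁺′ _ (replicate-word n b (ℕP.≤-trans (ℕP.m≤m+n (suc b) (length ls)) fits′) l)
    (∈-map⁺ (replicate l b ∷_) (superstandard-filling n (suc b) ls fits′))
  where
  fits′ : suc b + length ls ≤ n
  fits′ = subst (_≤ n) (ℕP.+-suc b (length ls)) fits

superstandard-ssyt : ∀ b ls → T (isSSYTᵇ (superstandard b ls))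
superstandard-ssyt b ls = T-∧⁺ (rows b ls) (columns b ls)
  where
  constant-row : ∀ l b → T (weaklyIncᵇ (replicate l b))
  constant-row zero b = tt
  constant-row (suc zero) b = tt
  constant-row (suc (suc l)) b = T-∧⁺ (ℕP.≤⇒≤ᵇ (ℕP.≤-refl {b})) (constant-row (suc l) b)
  next-letter : ∀ l l' b → T (allᵇ (λ { (a , c) → a <ᵇ c }) (zip (replicate l b) (replicate l' (suc b))))
  next-letter zero l' b = tt
  next-letter (suc l) zero b = tt
  next-letter (suc l) (suc l') b = T-∧⁺ (ℕP.<⇒<ᵇ (ℕP.n<1+n b)) (next-letter l l' b)
  rows : ∀ b ls → T (allᵇ weaklyIncᵇ (superstandard b ls))
  rows b [] = tt
  rows b (l ∷ ls) = T-∧⁺ (constant-row l b) (rows (suc b) ls)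
  columns : ∀ b ls → T (colStrictᵇ (superstandard b ls))
  columns b [] = tt
  columns b (l ∷ []) = tt
  columns b (l ∷ l' ∷ ls) = T-∧⁺ (next-letter l l' b) (columns (suc b) (l' ∷ ls))

countℕ-++ : ∀ c xs ys → countℕ c (xs ++ ys) ≡ countℕ c xs + countℕ c ys
countℕ-++ c [] ys = refl
countℕ-++ c (x ∷ xs) ys =
  trans (cong (ℕ._+_ (if x ≡ᵇ c then 1 else 0)) (countℕ-++ c xs ys)) (sym (ℕP.+-assoc (if x ≡ᵇ c then 1 else 0) _ _))

countℕ-absent : ∀ c xs → All (_≢ c) xs → countℕ c xs ≡ 0
countℕ-absent c [] [] = refl
countℕ-absent c (x ∷ xs) (x≢c ∷ rest) with x ≡ᵇ c in eq
... | true = ⊥-elim (x≢c (ℕP.≡ᵇ⇒≡ x c (subst T (sym eq) tt)))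
... | false = countℕ-absent c xs rest

countℕ-replicate : ∀ l b → countℕ b (replicate l b) ≡ l
countℕ-replicate zero b = refl
countℕ-replicate (suc l) b with b ≡ᵇ b in eq
... | true = cong suc (countℕ-replicate l b)
... | false = ⊥-elim (subst T eq (ℕP.≡⇒≡ᵇ b b refl))

superstandard-entries : ∀ b ls → All (b ≤_) (concat (superstandard b ls))
superstandard-entries b [] = []
superstandard-entries b (l ∷ ls) =
  AllP.++⁺ (AllP.replicate⁺ l ℕP.≤-refl) (All.map (ℕP.≤-trans (ℕP.n≤1+n b)) (superstandard-entries (suc b) ls))

superstandard-count : ∀ {m} b (ν : Vec ℕ m) (k : Fin m) →
  countℕ (b + toℕ k) (concat (superstandard b (toList ν))) ≡ lookup ν k
superstandard-count b (l ∷ ν) F.zero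
  rewrite ℕP.+-identityʳ b | countℕ-++ b (replicate l b) (concat (superstandard (suc b) (toList ν)))
        | countℕ-replicate l b
        | countℕ-absent b _ (All.map (λ b<x → ℕP.>⇒≢ b<x) (superstandard-entries (suc b) (toList ν))) = ℕP.+-identityʳ l
superstandard-count b (l ∷ ν) (F.suc k)
  rewrite countℕ-++ (b + suc (toℕ k)) (replicate l b) (concat (superstandard (suc b) (toList ν)))
        | countℕ-absent (b + suc (toℕ k)) (replicate l b) (AllP.replicate⁺ l (ℕP.<⇒≢ (ℕP.m<m+n b (s≤s z≤n))))
        | ℕP.+-suc b (toℕ k) = superstandard-count (suc b) ν k

superstandard-content : ∀ n (μ : Vec ℕ n) → content n (superstandard 0 (toList μ)) ≡ μ
superstandard-content n μ = trans (VP.tabulate-cong (superstandard-count 0 μ)) (VP.tabulate∘lookup μ)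

schur-diagonal : ∀ n (μ : Vec ℕ n) → coeff (schur n μ) μ ≢ + 0
schur-diagonal n μ c≡0 with coeff-unitTerms (schur n μ) μ (AllP.map⁺ (All.universal (λ _ → refl) _))
... | k , c≡k , pos = ℕP.<⇒≢ (pos μ-occurs) (sym (ℤP.+-injective (trans (sym c≡k) c≡0)))
  where
  μ-occurs : μ occursIn schur n μ
  μ-occurs = AnyP.map⁺ (lose (∈-filterᵇ⁺ isSSYTᵇ _ (superstandard-filling n 0 (toList μ) (ℕP.≤-reflexive (VP.length-toList μ)))
                                                      (superstandard-ssyt 0 (toList μ)))
                              (superstandard-content n μ))

sumBelow-mono : ∀ N {f g : ℕ → ℕ} → (∀ k → f k ≤ g k) → sumBelow N f ≤ sumBelow N g
sumBelow-mono zero _ = z≤n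
sumBelow-mono (suc N) f≤g = ℕP.+-mono-≤ (f≤g 0) (sumBelow-mono N (λ k → f≤g (suc k)))

squeeze : ∀ {a b c d} → a ≤ c → b ≤ d → c + d ≤ a + b → a ≡ c × d ≤ b
squeeze {a} {b} {c} {d} a≤c b≤d cd≤ab = a≡c , ℕP.+-cancelˡ-≤ a d b (subst (λ x → x + d ≤ a + b) (sym a≡c) cd≤ab)
  where
  a≡c : a ≡ c
  a≡c = ℕP.≤-antisym a≤c (ℕP.+-cancelʳ-≤ d c a (ℕP.≤-trans cd≤ab (ℕP.+-monoʳ-≤ a b≤d)))

sumBelow-rigid : ∀ N {f g : ℕ → ℕ} → (∀ k → f k ≤ g k) → sumBelow N g ≤ sumBelow N f → ∀ k → k < N → f k ≡ g k
sumBelow-rigid (suc N) {f} {g} f≤g Σg≤Σf k k<N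
  with squeeze (f≤g 0) (sumBelow-mono N (λ k → f≤g (suc k))) Σg≤Σf
sumBelow-rigid (suc N) f≤g Σg≤Σf zero _ | f0≡g0 , _ = f0≡g0
sumBelow-rigid (suc N) f≤g Σg≤Σf (suc k) (s≤s k<N) | _ , tail≤ = sumBelow-rigid N (λ k → f≤g (suc k)) tail≤ k k<N

prefixSum-injective : ∀ {n} (μ ν : Vec ℕ n) → (∀ k → k < suc n → prefixSum k μ ≡ prefixSum k ν) → μ ≡ ν
prefixSum-injective [] [] _ = refl
prefixSum-injective (a ∷ μ) (b ∷ ν) same = cong₂ _∷_ a≡b (prefixSum-injective μ ν tails)
  where
  a≡b : a ≡ b
  a≡b = trans (sym (ℕP.+-identityʳ a)) (trans (same 1 (s≤s (s≤s z≤n))) (ℕP.+-identityʳ b))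
  tails : ∀ k → k < suc _ → prefixSum k μ ≡ prefixSum k ν
  tails k k<n = ℕP.+-cancelˡ-≡ a _ _ (trans (same (suc k) (s≤s k<n)) (cong (λ x → x + prefixSum k ν) (sym a≡b)))

-- Φ v = Σ_{k ≤ n} (v₁ + ⋯ + v_k) is strictly monotone for the dominance order.
Φ : ∀ {n} → Vec ℕ n → ℕ
Φ {n} v = sumBelow (suc n) (λ k → prefixSum k v)

Φ-rigid : ∀ {n} (ν μ : Vec ℕ n) → ν ⊵ μ → Φ ν ≤ Φ μ → μ ≡ ν
Φ-rigid {n} ν μ ν⊵μ Φν≤Φμ = prefixSum-injective μ ν (sumBelow-rigid (suc n) ν⊵μ Φν≤Φμ)

sumℤ-multiple : ∀ {A : Set} (g : A → ℤ) z xs → All (λ x → g x ≡ + 0 ⊎ g x ≡ z) xs →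
  ∃ λ k → sumℤ (map g xs) ≡ + k ℤ.* z × (Any (λ x → g x ≡ z) xs → z ≢ + 0 → 1 ≤ k)
sumℤ-multiple g z [] [] = 0 , refl , λ ()
sumℤ-multiple g z (x ∷ xs) (gx ∷ rest) with sumℤ-multiple g z xs rest | gx
... | k , Σ≡kz , pos | inj₁ gx≡0 =
  k , trans (cong₂ ℤ._+_ gx≡0 Σ≡kz) (ℤP.+-identityˡ _)
    , λ { (here gx≡z) z≢0 → ⊥-elim (z≢0 (trans (sym gx≡z) gx≡0)) ; (there a) → pos a }
... | k , Σ≡kz , _ | inj₂ gx≡z =
  suc k , trans (cong₂ ℤ._+_ gx≡z Σ≡kz) (one-more k) , λ _ _ → s≤s z≤n
  where
  one-more : ∀ k → z ℤ.+ + k ℤ.* z ≡ + suc k ℤ.* z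
  one-more k = trans (cong (ℤ._+ (+ k ℤ.* z)) (sym (ℤP.*-identityˡ z))) (sym (ℤP.*-distribʳ-+ z (+ 1) (+ k)))

sumℤ-nonzero : ∀ {A : Set} (g : A → ℤ) z xs → z ≢ + 0 → All (λ x → g x ≡ + 0 ⊎ g x ≡ z) xs →
  Any (λ x → g x ≡ z) xs → sumℤ (map g xs) ≢ + 0
sumℤ-nonzero g z xs z≢0 terms some Σ≡0 with sumℤ-multiple g z xs terms
... | k , Σ≡kz , pos with ℤP.i*j≡0⇒i≡0∨j≡0 (+ k) (trans (sym Σ≡kz) Σ≡0)
...   | inj₁ k≡0 = ℕP.<⇒≢ (pos some z≢0) (sym (ℤP.+-injective k≡0))
...   | inj₂ z≡0 = z≢0 z≡0

coeff-scale≢0⁻ : ∀ {n} c (p : Poly n) e → coeff (scale c p) e ≢ + 0 → c ≢ + 0 × coeff p e ≢ + 0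
coeff-scale≢0⁻ c p e ≢0 = (λ c≡0 → ≢0 (trans (coeff-scale c p e) (cong (ℤ._* coeff p e) c≡0)))
                        , (λ p≡0 → ≢0 (trans (coeff-scale c p e) (trans (cong (c ℤ.*_) p≡0) (ℤP.*-zeroʳ c))))

coeff-scale≢0⁺ : ∀ {n} c (p : Poly n) e → c ≢ + 0 → coeff p e ≢ + 0 → coeff (scale c p) e ≢ + 0
coeff-scale≢0⁺ c p e c≢0 p≢0 ≡0 with ℤP.i*j≡0⇒i≡0∨j≡0 c (trans (sym (coeff-scale c p e)) ≡0)
... | inj₁ c≡0 = c≢0 c≡0
... | inj₂ p≡0 = p≢0 p≡0

-- Indeed every other ν contributing to x^μ dominates μ, hence equals μ by Φ-maximality.
schurExpansion-leading : ∀ n (ps : List (Vec ℕ n)) (c : Vec ℕ n → ℤ) μ →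
  All IsPartition ps → μ ∈ ps → c μ ≢ + 0 →
  (∀ ν → ν ∈ ps → c ν ≢ + 0 → ν ⊵ μ → Φ ν ≤ Φ μ) →
  coeff (concatMap (λ ν → scale (c ν) (schur n ν)) ps) μ ≢ + 0
schurExpansion-leading n ps c μ partitions μ∈ps cμ≢0 maximal coeff≡0 =
  sumℤ-nonzero term (term μ) ps term-μ≢0 (All.tabulate only-μ) (lose μ∈ps refl)
    (trans (sym (coeff-concatMap (λ ν → scale (c ν) (schur n ν)) ps μ)) coeff≡0)
  where
  term : Vec ℕ n → ℤ
  term ν = coeff (scale (c ν) (schur n ν)) μ
  term-μ≢0 : term μ ≢ + 0
  term-μ≢0 = coeff-scale≢0⁺ (c μ) (schur n μ) μ cμ≢0 (schur-diagonal n μ)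
  only-μ : ∀ {ν} → ν ∈ ps → term ν ≡ + 0 ⊎ term ν ≡ term μ
  only-μ {ν} ν∈ps with term ν ℤP.≟ + 0
  ... | yes term≡0 = inj₁ term≡0
  ... | no term≢0 = inj₂ (cong term (sym μ≡ν))
    where
    nonzero : c ν ≢ + 0 × coeff (schur n ν) μ ≢ + 0
    nonzero = coeff-scale≢0⁻ (c ν) (schur n ν) μ term≢0
    ν⊵μ : ν ⊵ μ
    ν⊵μ = schur-dominated n ν μ (All.lookup partitions ν∈ps) (proj₂ nonzero)
    μ≡ν : μ ≡ ν
    μ≡ν = Φ-rigid ν μ ν⊵μ (maximal ν ν∈ps (proj₁ nonzero) ν⊵μ)

maximal-element : ∀ {A : Set} {P : A → Set} → Decidable P → (f : A → ℕ) → ∀ {x} xs → x ∈ xs → P x →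
  ∃ λ y → y ∈ xs × P y × (∀ z → z ∈ xs → P z → f z ≤ f y)
maximal-element {A} {P} P? f {x} xs x∈xs px = y , y∈xs , py , maximal
  where
  y : A
  y = argmax f x (filter P? xs)
  y∈xs : y ∈ xs
  y∈xs with argmax-sel f x (filter P? xs)
  ... | inj₁ y≡x = subst (_∈ xs) (sym y≡x) x∈xs
  ... | inj₂ y∈ = proj₁ (∈-filter⁻ P? y∈)
  py : P y
  py = argmax-all f {xs = filter P? xs} px (All.tabulate (λ z∈ → proj₂ (∈-filter⁻ P? {xs = xs} z∈)))
  maximal : ∀ z → z ∈ xs → P z → f z ≤ f y
  maximal z z∈xs pz = All.lookup (f[xs]≤f[argmax] x (filter P? xs)) (∈-filter⁺ P? z∈xs pz)

decreasing-reflects : ∀ xs → T (decreasingᵇ xs) → Decreasing xs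
decreasing-reflects [] _ = []
decreasing-reflects (a ∷ []) _ = [ a ]
decreasing-reflects (a ∷ b ∷ xs) dec =
  ℕP.≤ᵇ⇒≤ b a (proj₁ (T-∧⁻ {b ≤ᵇ a} dec)) ∷ decreasing-reflects (b ∷ xs) (proj₂ (T-∧⁻ {b ≤ᵇ a} dec))

decreasing-decides : ∀ {xs} → Decreasing xs → T (decreasingᵇ xs)
decreasing-decides [] = _
decreasing-decides [ a ] = _
decreasing-decides (b≤a ∷ dec) = T-∧⁺ (ℕP.≤⇒≤ᵇ b≤a) (decreasing-decides dec)

boundedVecs-complete : ∀ {n} b (v : Vec ℕ n) → sum v ≤ b → v ∈ boundedVecs n b
boundedVecs-complete b [] _ = here refl
boundedVecs-complete {suc n} b (x ∷ v) x+v≤b =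
  ∈-concatMap⁺′ _ (∈-upTo⁺ (s≤s (ℕP.≤-trans (ℕP.m≤m+n x (sum v)) x+v≤b)))
    (∈-map⁺ (x ∷_) (boundedVecs-complete b v (ℕP.≤-trans (ℕP.m≤n+m (sum v) x) x+v≤b)))

partitions-complete : ∀ n N (v : Vec ℕ n) → IsPartition v → sum v ≡ N → v ∈ partitions n N
partitions-complete n N v dec refl = ∈-filterᵇ⁺ _ (boundedVecs n N) (boundedVecs-complete N v ℕP.≤-refl)
  (T-∧⁺ (decreasing-decides dec) (ℕP.≡⇒≡ᵇ (sum v) (sum v) refl))

partitions-sound : ∀ n N → All IsPartition (partitions n N)
partitions-sound n N = All.tabulate λ {v} v∈ →
  decreasing-reflects (toList v) (proj₁ (T-∧⁻ {decreasingᵇ (toList v)} (proj₂ (∈-filterᵇ⁻ _ (boundedVecs n N) v∈))))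

prefixSum-constant : ∀ {n} i (v : Vec ℕ n) C D → i ≤ n → (∀ (k : Fin n) → toℕ k < i → lookup v k + C ≡ D) →
  prefixSum i v + i * C ≡ i * D
prefixSum-constant zero v C D _ _ = refl
prefixSum-constant (suc i) (x ∷ v) C D (s≤s i≤n) rows = begin
  x + prefixSum i v + suc i * C        ≡⟨ regroup x (prefixSum i v) C i ⟩
  (x + C) + (prefixSum i v + i * C)    ≡⟨ cong₂ _+_ (rows F.zero (s≤s z≤n)) rest ⟩
  D + i * D ∎
  where
  open ≡-Reasoning
  rest : prefixSum i v + i * C ≡ i * D
  rest = prefixSum-constant i v C D i≤n (λ k k<i → rows (F.suc k) (s≤s k<i))
  regroup : ∀ x w C i → x + w + suc i * C ≡ (x + C) + (w + i * C)
  regroup = solve-∀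

Candidate : ∀ {n} → (Vec ℕ n → ℤ) → ℕ → ℕ → Vec ℕ n → Set
Candidate c i W ν = c ν ≢ + 0 × W ≤ prefixSum i ν

candidate? : ∀ {n} (c : Vec ℕ n → ℤ) i W → Decidable (Candidate c i W)
candidate? c i W ν = ¬? (c ν ℤP.≟ + 0) ×-dec (W ℕP.≤? prefixSum i ν)

i≤m-from-bounds : ∀ n i m W W′ → 1 ≤ i → W ≤ W′ → W′ + i * i + i ≤ 2 * n * i → W + i * (m + 1) ≡ i * (2 * n) → i ≤ m
i≤m-from-bounds n i@(suc _) m W W′ _ W≤W′ upper exact =
  ℕP.≤-pred (subst₂ _≤_ (ℕP.+-comm i 1) (ℕP.+-comm m 1) (ℕP.*-cancelˡ-≤ i compare))
  where
  open ℕP.≤-Reasoning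
  compare : i * (i + 1) ≤ i * (m + 1)
  compare = ℕP.+-cancelˡ-≤ W _ _ (begin
    W + i * (i + 1)     ≡⟨ cong (ℕ._+_ W) (square i) ⟩
    W + (i * i + i)     ≡⟨ ℕP.+-assoc W (i * i) i ⟨
    W + i * i + i       ≤⟨ ℕP.+-monoˡ-≤ i (ℕP.+-monoˡ-≤ (i * i) W≤W′) ⟩
    W′ + i * i + i      ≤⟨ upper ⟩
    2 * n * i           ≡⟨ ℕP.*-comm (2 * n) i ⟩
    i * (2 * n)         ≡⟨ exact ⟨
    W + i * (m + 1) ∎)
    where
    square : ∀ i → i * (i + 1) ≡ i * i + i
    square = solve-∀

mainTheorem6 : (n : ℕ) → 1 ≤ n →
  (λ' : Vec ℕ n) → IsPartition λ' → sum λ' ≡ n * (n ∸ 1) →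
  n ∸ 1 ≤ len λ' → len λ' ≤ n →
  (c : Vec ℕ n → ℤ) →
  vandermonde n ⊗ vandermonde n ≈ schurExpansion n (n * (n ∸ 1)) c →
  c λ' ≢ + 0 →
  (i m : ℕ) → 1 ≤ i → i ≤ n → 1 ≤ m →
  (∀ (k : Fin n) → toℕ k < i → lookup λ' k + m + 1 ≡ 2 * n) →
  i ≤ m
mainTheorem6 n _ λ' λ-partition λ-size _ _ c a²≈expansion cλ≢0 i m 1≤i i≤n _ λ-rows
  with maximal-element (candidate? c i (prefixSum i λ')) Φ (partitions n (n * (n ∸ 1)))
         (partitions-complete n _ λ' λ-partition λ-size) (cλ≢0 , ℕP.≤-refl)
... | μ , μ∈ps , (cμ≢0 , λ≤μ) , maximal =
  i≤m-from-bounds n i m (prefixSum i λ') (prefixSum i μ) 1≤i λ≤μ (vandermonde²-bound n i i≤n μ a²-at-μ≢0) λ-first-rows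
  where
  -- Any ν in the support dominating μ is itself a candidate, so Φ ν ≤ Φ μ.
  μ-leading : ∀ ν → ν ∈ partitions n (n * (n ∸ 1)) → c ν ≢ + 0 → ν ⊵ μ → Φ ν ≤ Φ μ
  μ-leading ν ν∈ps cν≢0 ν⊵μ = maximal ν ν∈ps (cν≢0 , ℕP.≤-trans λ≤μ (ν⊵μ i))
  a²-at-μ≢0 : coeff (vandermonde n ⊗ vandermonde n) μ ≢ + 0
  a²-at-μ≢0 a²≡0 = schurExpansion-leading n _ c μ (partitions-sound n _) μ∈ps cμ≢0 μ-leading
    (trans (sym (a²≈expansion μ)) a²≡0)
  λ-first-rows : prefixSum i λ' + i * (m + 1) ≡ i * (2 * n)
  λ-first-rows = prefixSum-constant i λ' (m + 1) (2 * n) i≤n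
    (λ k k<i → trans (sym (ℕP.+-assoc (lookup λ' k) m 1)) (λ-rows k k<i))
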